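{- Let $p,q$ be distinct atomic propositions. The following two ICTL formulae are not valid: (1) $\mathsf{A}(p\mathsf{U}q)\to q\vee(p\wedge\mathsf{A}\mathsf{X}\,\mathsf{A}(p\mathsf{U}q))$; (2) $\mathsf{A}(q\mathsf{R}p)\to p\wedge(q\vee\mathsf{A}\mathsf{X}\,\mathsf{A}(q\mathsf{R}p))$.
   Context: Fix a countable set $\mathcal P$ of atomic propositions. ICTL formulae are given by the grammar $\varphi,\psi ::= p\mid\bot\mid\varphi\wedge\psi\mid\varphi\vee\psi\mid\varphi\to\psi\mid \mathsf{E}\mathsf{X}\varphi\mid\mathsf{E}(\varphi\mathsf{U}\psi)\mid\mathsf{E}(\varphi\mathsf{R}\psi)\mid\mathsf{A}\mathsf{X}\varphi\mid\mathsf{A}(\varphi\mathsf{U}\psi)\mid\mathsf{A}(\varphi\mathsf{R}\psi)$ with $p\in\mathcal P$. A birelational frame is $\langle W,P,R\rangle$ with $W$ a non-empty countable set, $P$ a preorder on $W$, $R$ a serial relation on $W$, satisfying for all $x,y,z$: (C1) if $x\,R\,y$ and $y\,P\,z$ then there is $u$ with $x\,P\,u$ and $u\,R\,z$; (C2) if $x\,P\,z$ and $x\,R\,y$ then there is $u$ with $y\,P\,u$ and $z\,R\,u$. A path is an infinite sequence $\rho_0,\rho_1,\ldots$ with $\rho_i\,R\,\rho_{i+1}$ for all $i$. A birelational model $\langle W,P,R,\mathcal V\rangle$ adds $\mathcal V:W\to2^{\mathcal P}$ with $w\,P\,w'\Rightarrow\mathcal V(w)\subseteq\mathcal V(w')$.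 Satisfaction: $w\models p$ iff $p\in\mathcal V(w)$; $w\not\models\bot$; $\wedge,\vee$ pointwise; $w\models\alpha\to\beta$ iff for every $w'$ with $w\,P\,w'$, $w'\models\alpha$ implies $w'\models\beta$; $w\models\mathsf{E}\mathsf{X}\alpha$ iff there is a path $\rho$ with $\rho_0=w$ and $\rho_1\models\alpha$; $w\models\mathsf{E}(\alpha\mathsf{U}\beta)$ iff there is a path $\rho$ with $\rho_0=w$ and $j\ge0$ with $\rho_j\models\beta$ and $\rho_i\models\alpha$ for all $0\le i<j$; $w\models\mathsf{E}(\alpha\mathsf{R}\beta)$ iff there is a path $\rho$ with $\rho_0=w$ such that either $\rho_i\models\beta$ for all $i$ or there is $j\ge0$ with $\rho_j\models\alpha$ and $\rho_i\models\beta$ for all $0\le i\le j$; $w\models\mathsf{A}\mathsf{X}\alpha$ iff for every $w'$ with $w\,P\,w'$ and every path $\rho$ with $\rho_0=w'$, $\rho_1\models\alpha$; $w\models\mathsf{A}(\alpha\mathsf{U}\beta)$ iff for every $w'$ with $w\,P\,w'$ and every path $\rho$ with $\rho_0=w'$ there is $j\ge0$ with $\rho_j\models\beta$ and $\rho_i\models\alpha$ for $0\le i<j$; $w\models\mathsf{A}(\alpha\mathsf{R}\beta)$ iff for every $w'$ with $w\,P\,w'$ and every path $\rho$ with $\rho_0=w'$, either $\rho_i\models\beta$ for all $i$ or there is $j\ge0$ with $\rho_j\models\alpha$ and $\rho_i\models\beta$ for all $0\le i\le j$. A formula is valid iff it is satisfied at every world of every birelational model; "not valid" means some world of some birelational model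 does not satisfy it. -}

module Defs where

open import Data.Nat using (ℕ; suc; _<_; _≤_)
open import Data.Empty using (⊥)
open import Data.Product using (Σ; ∃; _×_; _,_)
open import Data.Sum using (_⊎_)
open import Relation.Nullary using (¬_)
open import Relation.Binary.PropositionalEquality using (_≡_)
open import Function.Definitions using (Injective)

-- Atomic propositions: the countable set 𝒫 is taken to be ℕ.
Atom : Set
Atom = ℕ

data Form : Set where
  atom : Atom → Form
  ⊥'   : Form
  _∧'_ : Form → Form → Form
  _∨'_ : Form → Form → Form
  _⇒_  : Form → Form → Form
  EX   : Form → Form
  EU   : Form → Form → Form
  ER   : Form → Form → Form
  AX   : Form → Form
  AU   : Form → Form → Form
  AR   : Form → Form → Form

infixr 6 _∧'_
infixr 5 _∨'_
infixr 4 _⇒_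

record Frame : Set₁ where
  field
    W        : Set
    inhabited : W
    enc      : W → ℕ                     -- countability of W
    enc-inj  : Injective _≡_ _≡_ enc
    P        : W → W → Set
    R        : W → W → Set
    P-refl   : ∀ x → P x x
    P-trans  : ∀ {x y z} → P x y → P y z → P x z
    R-serial : ∀ x → ∃ λ y → R x y
    C1 : ∀ {x y z} → R x y → P y z → ∃ λ u → P x u × R u z
    C2 : ∀ {x y z} → P x z → R x y → ∃ λ u → P y u × R z u

record Model : Set₁ where
  field
    frame : Frame
  open Frame frame public
  field
    V     : W → Atom → Set
    V-mono : ∀ {w w'} → P w w' → ∀ a → V w a → V w' a

module _ (M : Model) where
  open Model M

  record Path : Set where
    field
      seq  : ℕ → W
      step : ∀ i → R (seq i) (seq (suc i))
  open Path public

  UntilOn : (W → Set) → (W → Set) → Path → Set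
  UntilOn α β ρ = ∃ λ j → β (seq ρ j) × (∀ i → i < j → α (seq ρ i))

  ReleaseOn : (W → Set) → (W → Set) → Path → Set
  ReleaseOn α β ρ =
    (∀ i → β (seq ρ i)) ⊎
    (∃ λ j → α (seq ρ j) × (∀ i → i ≤ j → β (seq ρ i)))

  infix 3 _⊨_
  _⊨_ : W → Form → Set
  w ⊨ atom a = V w a
  w ⊨ ⊥' = ⊥
  w ⊨ φ ∧' ψ = (w ⊨ φ) × (w ⊨ ψ)
  w ⊨ φ ∨' ψ = (w ⊨ φ) ⊎ (w ⊨ ψ)
  w ⊨ φ ⇒ ψ = ∀ w' → P w w' → w' ⊨ φ → w' ⊨ ψ
  w ⊨ EX φ = Σ Path λ ρ → seq ρ 0 ≡ w × (seq ρ 1 ⊨ φ)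
  w ⊨ EU φ ψ = Σ Path λ ρ → seq ρ 0 ≡ w × UntilOn (_⊨ φ) (_⊨ ψ) ρ
  w ⊨ ER φ ψ = Σ Path λ ρ → seq ρ 0 ≡ w × ReleaseOn (_⊨ φ) (_⊨ ψ) ρ
  w ⊨ AX φ = ∀ w' → P w w' → (ρ : Path) → seq ρ 0 ≡ w' → seq ρ 1 ⊨ φ
  w ⊨ AU φ ψ = ∀ w' → P w w' → (ρ : Path) → seq ρ 0 ≡ w' → UntilOn (_⊨ φ) (_⊨ ψ) ρ
  w ⊨ AR φ ψ = ∀ w' → P w w' → (ρ : Path) → seq ρ 0 ≡ w' → ReleaseOn (_⊨ φ) (_⊨ ψ) ρ

Valid : Form → Set₁
Valid φ = (M : Model) → (w : Model.W M) → _⊨_ M w φ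

NotValid : Form → Set₁
NotValid φ = Σ Model λ M → Σ (Model.W M) λ w → ¬ (_⊨_ M w φ)

-- Universal path quantifiers range over the paths from every P-successor.  Take worlds
-- a ⊑ u with a ↝ u, u ↝ u, u ↝ v, v ↝ v, where a satisfies p, u satisfies p and q, and v
-- satisfies nothing.  Both A(p U q) and A(q R p) hold at a, since every path from a or u
-- reaches u, which satisfies p and q.  But through a ⊑ u ↝ v, AX of either formula at a
-- would force it at v, which is impossible as v satisfies no atom; and a does not satisfy
-- q because p ≢ q.
module Submission where

open import Defs
open import Data.Nat using (ℕ; zero; suc; z≤n; s≤s)
open import Data.Nat.GeneralisedArithmetic using (fold)
open import Data.Empty using (⊥)
open import Data.Product using (_×_; _,_; ∃; proj₁; proj₂)
open import Data.Sum using (_⊎_; inj₁; inj₂; [_,_]′)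
open import Function using (_∘_; id)
open import Function.Definitions using (Injective)
open import Function.Consequences.Propositional
  using (inverseʳ⇒injective; strictlyInverseʳ⇒inverseʳ)
open import Relation.Nullary using (¬_)
open import Relation.Binary.PropositionalEquality using (_≡_; _≢_; refl; sym)

module Semantics (M : Model) where
  open Model M

  infix 3 _⊩_
  _⊩_ : W → Form → Set
  _⊩_ = _⊨_ M

  serialPath : W → Path M
  serialPath x = record
    { seq  = fold x successor
    ; step = λ i → proj₂ (R-serial (fold x successor i))
    }
    where
    successor : W → W
    successor y = proj₁ (R-serial y)

  prepend : ∀ {x y} → R x y → Path M
  prepend {x} {y} xRy = record { seq = seq′ ; step = step′ }
    where
    ρ = serialPath y
    seq′ : ℕ → W
    seq′ zero    = x
    seq′ (suc i) = Path.seq ρ i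
    step′ : ∀ i → R (seq′ i) (seq′ (suc i))
    step′ zero    = xRy
    step′ (suc i) = Path.step ρ i

  AX-elim : ∀ {w w′ w″} φ → w ⊩ AX φ → P w w′ → R w′ w″ → w″ ⊩ φ
  AX-elim _ w⊩AXφ wPw′ w′Rw″ = w⊩AXφ _ wPw′ (prepend w′Rw″) refl

  AU⇒ψ⊎φ : ∀ {w} φ ψ → w ⊩ AU φ ψ → (w ⊩ ψ) ⊎ (w ⊩ φ)
  AU⇒ψ⊎φ {w} _ _ w⊩AU with w⊩AU w (P-refl w) (serialPath w) refl
  ... | zero  , ψ₀ , _  = inj₁ ψ₀
  ... | suc _ , _  , φ< = inj₂ (φ< 0 (s≤s z≤n))

  AR⇒ψ : ∀ {w} φ ψ → w ⊩ AR φ ψ → w ⊩ ψ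
  AR⇒ψ {w} _ _ w⊩AR with w⊩AR w (P-refl w) (serialPath w) refl
  ... | inj₁ always       = always 0
  ... | inj₂ (_ , _ , ψ≤) = ψ≤ 0 z≤n

data World : Set where
  a u v : World

encode : World → ℕ
encode a = 0
encode u = 1
encode v = 2

decode : ℕ → World
decode 0 = a
decode 1 = u
decode _ = v

decode-encode : ∀ x → decode (encode x) ≡ x
decode-encode a = refl
decode-encode u = refl
decode-encode v = refl

encode-injective : Injective _≡_ _≡_ encode
encode-injective =
  inverseʳ⇒injective encode (strictlyInverseʳ⇒inverseʳ {f⁻¹ = decode} encode decode-encode)

infix 4 _⊑_ _↝_

data _⊑_ : World → World → Set where
  ⊑-refl : ∀ {x} → x ⊑ x
  a⊑u    : a ⊑ u

data _↝_ : World → World → Set where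
  a↝u : a ↝ u
  u↝u : u ↝ u
  u↝v : u ↝ v
  v↝v : v ↝ v

⊑-trans : ∀ {x y z} → x ⊑ y → y ⊑ z → x ⊑ z
⊑-trans ⊑-refl y⊑z    = y⊑z
⊑-trans a⊑u    ⊑-refl = a⊑u

↝-serial : ∀ x → ∃ λ y → x ↝ y
↝-serial a = u , a↝u
↝-serial u = u , u↝u
↝-serial v = v , v↝v

↝-⊑-commute : ∀ {x y z} → x ↝ y → y ⊑ z → ∃ λ w → x ⊑ w × w ↝ z
↝-⊑-commute x↝y ⊑-refl = _ , ⊑-refl , x↝y

⊑-↝-commute : ∀ {x y z} → x ⊑ z → x ↝ y → ∃ λ w → y ⊑ w × z ↝ w
⊑-↝-commute ⊑-refl x↝y = _ , ⊑-refl , x↝y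
⊑-↝-commute a⊑u    a↝u = u , ⊑-refl , u↝u

frame : Frame
frame = record
  { W = World ; inhabited = a ; enc = encode ; enc-inj = encode-injective
  ; P = _⊑_ ; R = _↝_ ; P-refl = λ _ → ⊑-refl ; P-trans = ⊑-trans
  ; R-serial = ↝-serial ; C1 = ↝-⊑-commute ; C2 = ⊑-↝-commute
  }

module Counterexample (p q : Atom) where

  valuation : World → Atom → Set
  valuation a x = x ≡ p
  valuation u x = x ≡ p ⊎ x ≡ q
  valuation v x = ⊥

  valuation-mono : ∀ {x y} → x ⊑ y → ∀ r → valuation x r → valuation y r
  valuation-mono ⊑-refl _ = id
  valuation-mono a⊑u    _ = inj₁

  model : Model
  model = record { frame = frame ; V = valuation ; V-mono = valuation-mono }

  open Semantics model

  a⊩p : ∀ {x} → x ≡ a → x ⊩ atom p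
  a⊩p refl = refl

  u⊩p : ∀ {x} → x ≡ u → x ⊩ atom p
  u⊩p refl = inj₁ refl

  u⊩q : ∀ {x} → x ≡ u → x ⊩ atom q
  u⊩q refl = inj₂ refl

  a⊮q : p ≢ q → ¬ (a ⊩ atom q)
  a⊮q p≢q q≡p = p≢q (sym q≡p)

  v⊮ : ∀ r → ¬ (v ⊩ atom r)
  v⊮ _ ()

  ↝-from-a : ∀ {x y} → x ≡ a → x ↝ y → y ≡ u
  ↝-from-a refl a↝u = refl

  second-from-a : (ρ : Path model) → Path.seq ρ 0 ≡ a → Path.seq ρ 1 ≡ u
  second-from-a ρ ρ₀≡a = ↝-from-a ρ₀≡a (Path.step ρ 0)

  a⊩AU : a ⊩ AU (atom p) (atom q)
  a⊩AU .a ⊑-refl ρ ρ₀≡a =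
    1 , u⊩q (second-from-a ρ ρ₀≡a) , λ { 0 _ → a⊩p ρ₀≡a ; (suc _) (s≤s ()) }
  a⊩AU .u a⊑u    ρ ρ₀≡u = 0 , u⊩q ρ₀≡u , λ _ ()

  a⊩AR : a ⊩ AR (atom q) (atom p)
  a⊩AR .a ⊑-refl ρ ρ₀≡a =
    inj₂ (1 , u⊩q ρ₁≡u , λ { 0 _ → a⊩p ρ₀≡a ; 1 _ → u⊩p ρ₁≡u ; (suc (suc _)) (s≤s ()) })
    where ρ₁≡u = second-from-a ρ ρ₀≡a
  a⊩AR .u a⊑u    ρ ρ₀≡u = inj₂ (0 , u⊩q ρ₀≡u , λ { 0 _ → u⊩p ρ₀≡u })

  a⊮AX-AU : ¬ (a ⊩ AX (AU (atom p) (atom q)))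
  a⊮AX-AU a⊩AX = [ v⊮ q , v⊮ p ]′ (AU⇒ψ⊎φ (atom p) (atom q) v⊩AU)
    where v⊩AU = AX-elim (AU (atom p) (atom q)) a⊩AX a⊑u u↝v

  a⊮AX-AR : ¬ (a ⊩ AX (AR (atom q) (atom p)))
  a⊮AX-AR a⊩AX = v⊮ p (AR⇒ψ (atom q) (atom p) v⊩AR)
    where v⊩AR = AX-elim (AR (atom q) (atom p)) a⊩AX a⊑u u↝v

  a⊮AU-unfolding : p ≢ q →
    ¬ (a ⊩ AU (atom p) (atom q) ⇒ atom q ∨' (atom p ∧' AX (AU (atom p) (atom q))))
  a⊮AU-unfolding p≢q a⊩⇒ = [ a⊮q p≢q , a⊮AX-AU ∘ proj₂ ]′ (a⊩⇒ a ⊑-refl a⊩AU)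

  a⊮AR-unfolding : p ≢ q →
    ¬ (a ⊩ AR (atom q) (atom p) ⇒ atom p ∧' (atom q ∨' AX (AR (atom q) (atom p))))
  a⊮AR-unfolding p≢q a⊩⇒ = [ a⊮q p≢q , a⊮AX-AR ]′ (proj₂ (a⊩⇒ a ⊑-refl a⊩AR))

proposition4 : (p q : Atom) → p ≢ q →
    NotValid (AU (atom p) (atom q) ⇒ atom q ∨' (atom p ∧' AX (AU (atom p) (atom q))))
    × NotValid (AR (atom q) (atom p) ⇒ atom p ∧' (atom q ∨' AX (AR (atom q) (atom p))))
proposition4 p q p≢q =
  (model , a , a⊮AU-unfolding p≢q) , (model , a , a⊮AR-unfolding p≢q)
  where open Counterexample p q
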